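{- Let $n,m \in \mathbb{N}$ with $n \geq 2$, and let $G = \sum_{i=1}^n K_{1,m}$ be the disjoint union of $n$ copies of the star $K_{1,m}$. If $n$ is odd, then $G$ is equitably 2-choosable if and only if $m \leq 2$. If $n$ is even, then $G$ is equitably 2-choosable if and only if $m \leq 7$.
   Context: All graphs are finite and simple; $\mathbb{N}=\{1,2,3,\dots\}$. A list assignment $L$ for a graph $G$ assigns to each vertex $v$ a set $L(v)$ of colors; it is a $k$-assignment if $|L(v)|=k$ for all $v$. The palette of $L$ is $\bigcup_{v} L(v)$. A proper $L$-coloring is a proper coloring $f$ with $f(v)\in L(v)$ for all $v$. If $L$ is a $k$-assignment, an equitable $L$-coloring of $G$ is a proper $L$-coloring in which each color of the palette appears on at most $\lceil |V(G)|/k \rceil$ vertices. $G$ is equitably $k$-choosable if an equitable $L$-coloring exists for every $k$-assignment $L$ for $G$. -}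

module Defs where

open import Data.Nat using (ℕ; zero; suc; _+_; _*_; _∸_; _≤_; NonZero)
open import Data.Nat.DivMod using (_/_)
open import Data.Fin using (Fin; quotient; remainder)
import Data.Fin as Fin
open import Data.List using (List; length; filter)
open import Data.List.Membership.Propositional using (_∈_)
open import Data.List.Relation.Unary.Unique.Propositional using (Unique)
open import Data.Product using (_×_; _,_; ∃; ∃-syntax)
open import Data.Sum using (_⊎_; inj₁; inj₂)
import Relation.Binary.PropositionalEquality as Eq
open import Data.Empty using (⊥)
open import Relation.Nullary using (¬_)
open import Relation.Binary.PropositionalEquality using (_≡_; _≢_)
open import Data.Vec.Functional using ()
open import Data.List using (allFin)
import Data.Nat as ℕ

record Graph : Set₁ where
  field
    N     : ℕ
    Adj   : Fin N → Fin N → Set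
    sym   : ∀ {u v} → Adj u v → Adj v u
    irrefl : ∀ {v} → ¬ Adj v v
open Graph public

-- Colors are natural numbers.  A k-assignment gives each vertex a
-- duplicate-free list of exactly k colors (i.e. a k-element set).
record Assignment (G : Graph) (k : ℕ) : Set where
  field
    L       : Fin (N G) → List ℕ
    unique  : ∀ v → Unique (L v)
    size    : ∀ v → length (L v) ≡ k
open Assignment public

InPalette : ∀ {G k} → Assignment G k → ℕ → Set
InPalette A c = ∃[ v ] c ∈ L A v

colorCount : ∀ {N} → (Fin N → ℕ) → ℕ → ℕ
colorCount {N} f c = length (filter (λ v → f v ℕ.≟ c) (allFin N))

ceilDiv : (a k : ℕ) → .{{NonZero k}} → ℕ
ceilDiv a k = (a + k ∸ 1) / k

IsProperLColoring : ∀ {G k} → Assignment G k → (Fin (N G) → ℕ) → Set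
IsProperLColoring {G} A f =
  (∀ v → f v ∈ L A v) × (∀ u v → Adj G u v → f u ≢ f v)

IsEquitableLColoring : ∀ {G k} .{{_ : NonZero k}} → Assignment G k → (Fin (N G) → ℕ) → Set
IsEquitableLColoring {G} {k} A f =
  IsProperLColoring A f ×
  (∀ c → InPalette A c → colorCount f c ≤ ceilDiv (N G) k)

EquitablyChoosable : (G : Graph) (k : ℕ) .{{_ : NonZero k}} → Set
EquitablyChoosable G k =
  (A : Assignment G k) → ∃[ f ] IsEquitableLColoring A f

-- Disjoint union of n copies of the star K_{1,m}.
-- Vertex i ∈ Fin (n * suc m) is vertex (remainder i) of copy (quotient i);
-- within a copy, vertex 0 is the center and 1..m are the leaves.
IsCenter : ∀ {m} → Fin (suc m) → Set
IsCenter p = p ≡ Fin.zero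

starAdj : (n m : ℕ) → Fin (n * suc m) → Fin (n * suc m) → Set
starAdj n m u v =
  quotient {n} (suc m) u ≡ quotient {n} (suc m) v ×
  ((IsCenter (remainder {n} (suc m) u) × ¬ IsCenter (remainder {n} (suc m) v)) ⊎
   (¬ IsCenter (remainder {n} (suc m) u) × IsCenter (remainder {n} (suc m) v)))

starAdj-sym : ∀ n m {u v} → starAdj n m u v → starAdj n m v u
starAdj-sym n m (q , inj₁ (a , b)) = Eq.sym q , inj₂ (b , a)
starAdj-sym n m (q , inj₂ (a , b)) = Eq.sym q , inj₁ (b , a)

starAdj-irrefl : ∀ n m {v} → ¬ starAdj n m v v
starAdj-irrefl n m (_ , inj₁ (a , b)) = b a
starAdj-irrefl n m (_ , inj₂ (a , b)) = a b

starForest : (n m : ℕ) → Graph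
starForest n m = record
  { N = n * suc m ; Adj = starAdj n m
  ; sym = starAdj-sym n m ; irrefl = starAdj-irrefl n m }

-- Sufficiency.  Given a 2-assignment, first colour every centre from its
-- list.  A leaf whose list contains its centre's colour is then forced to its
-- other colour; every other leaf keeps two admissible colours.  The greedy
-- lemma (`greedy`) completes such a choice to an L-colouring with all colour
-- classes of size ≤ ⌈N/2⌉ as soon as no colour is forced more than ⌈N/2⌉
-- times.  To control forced colours the stars are paired up: by the two-star
-- lemma (`two-star-lemma`, the only place where m ≤ 7 enters) the centres of
-- two stars can be coloured so that no colour is forced more than m+1 times
-- within the pair.  For odd n one star is left over; it forces a colour at
-- most m times, which still fits exactly when m ≤ 2.
--
-- Necessity.  For odd n and m ≥ 3 give every vertex the list {0,1}; for even n
-- and m ≥ 8 do the same except on one special star whose lists force each of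
-- 0 and 1 at least twice.  The {0,1}-stars coloured "centre 0" and "centre 1"
-- differ in number by parity, and the majority makes one colour exceed ⌈N/2⌉.

module Submission where

open import Defs hiding (sym)
open import Data.Bool using (Bool; true; false)
open import Data.Empty using (⊥; ⊥-elim)
open import Data.Fin using (Fin; zero; suc; toℕ; fromℕ<; combine; quotient; remainder; _↑ˡ_; _↑ʳ_)
open import Data.Fin.Patterns using (0F; 1F; 2F; 3F; 4F; 5F; 6F; 7F; 8F)
open import Data.Fin.Properties using (remQuot-combine; combine-remQuot; all?; ¬∀⟶∃¬; toℕ-fromℕ<)
open import Data.List using (List; []; _∷_; length; filter; tabulate)
open import Data.List.Membership.Propositional using (_∈_)
open import Data.List.Relation.Unary.All using ([]; _∷_)
open import Data.List.Relation.Unary.AllPairs using ([]; _∷_)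
open import Data.List.Relation.Unary.Any using (here; there)
open import Data.List.Relation.Unary.Unique.Propositional using (Unique)
open import Data.Nat using (ℕ; zero; suc; _+_; _*_; _∸_; _≤_; _<_; z≤n; s≤s; _%_; _/_; _≟_; _≤?_; _<?_)
open import Data.Nat.DivMod using (m≡m%n+[m/n]*n; m*n/n≡m; m/n*n≤m; /-monoˡ-≤; m*n%n≡0; [m+kn]%n≡m%n)
open import Data.Nat.Properties
open import Data.Nat.Tactic.RingSolver using (solve-∀)
open import Data.Product using (Σ; _×_; _,_; proj₁; proj₂; ∃) renaming (swap to ×-swap)
open import Data.Sum using (_⊎_; inj₁; inj₂) renaming (swap to ⊎-swap)
import Data.Vec.Functional as Vector
open import Function using (_∘_)
open import Function.Bundles using (_⇔_; mk⇔)
open import Level using (0ℓ)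
open import Relation.Binary using (tri<; tri≈; tri>)
open import Relation.Binary.PropositionalEquality
open import Relation.Nullary using (¬_; Dec; yes; no)
open import Relation.Nullary.Decidable using (decidable-stable)
open import Relation.Unary using (Pred; Decidable)

open import Algebra.Properties.CommutativeSemigroup +-commutativeSemigroup using () renaming (interchange to +-interchange)
open import Algebra.Properties.CommutativeMonoid.Sum +-0-commutativeMonoid using (sum; ∑-distrib-+; sum-cong-≗; sum-replicate-zero)

sum-≤-card : ∀ {k} (f : Fin k → ℕ) → (∀ i → f i ≤ 1) → sum f ≤ k
sum-≤-card {zero} f f≤1 = z≤n
sum-≤-card {suc k} f f≤1 = +-mono-≤ (f≤1 zero) (sum-≤-card (f ∘ suc) (f≤1 ∘ suc))

sum-zeros : ∀ {k} (f : Fin k → ℕ) → (∀ i → f i ≡ 0) → sum f ≡ 0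
sum-zeros {k} f f≡0 = trans (sum-cong-≗ f≡0) (sum-replicate-zero k)

sum-ones : ∀ {k} (f : Fin k → ℕ) → (∀ i → f i ≡ 1) → sum f ≡ k
sum-ones {zero} f f≡1 = refl
sum-ones {suc k} f f≡1 = cong₂ _+_ (f≡1 zero) (sum-ones (f ∘ suc) (f≡1 ∘ suc))

term≤sum : ∀ {k} (f : Fin k → ℕ) i → f i ≤ sum f
term≤sum f zero = m≤m+n (f zero) _
term≤sum f (suc i) = ≤-trans (term≤sum (f ∘ suc) i) (m≤n+m _ (f zero))

two-terms≤sum : ∀ {k} (f : Fin k → ℕ) {i j} → i ≢ j → f i + f j ≤ sum f
two-terms≤sum f {zero} {zero} i≢j = ⊥-elim (i≢j refl)
two-terms≤sum f {zero} {suc j} _ = +-monoʳ-≤ (f zero) (term≤sum (f ∘ suc) j)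
two-terms≤sum f {suc i} {zero} _ =
  subst (_≤ sum f) (+-comm (f zero) (f (suc i))) (+-monoʳ-≤ (f zero) (term≤sum (f ∘ suc) i))
two-terms≤sum f {suc i} {suc j} i≢j =
  ≤-trans (two-terms≤sum (f ∘ suc) (i≢j ∘ cong suc)) (m≤n+m _ (f zero))

sum-split : ∀ a b (f : Fin (a + b) → ℕ) → sum f ≡ sum (λ i → f (i ↑ˡ b)) + sum (λ i → f (a ↑ʳ i))
sum-split zero b f = refl
sum-split (suc a) b f = trans (cong (f zero +_) (sum-split a b (f ∘ suc))) (sym (+-assoc (f zero) _ _))

sum-combine : ∀ n k (f : Fin (n * k) → ℕ) → sum f ≡ sum {n} (λ j → sum {k} (λ p → f (combine j p)))
sum-combine zero k f = refl
sum-combine (suc n) k f =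
  trans (sum-split k (n * k) f) (cong (sum (λ p → f (p ↑ˡ (n * k))) +_) (sum-combine n k (f ∘ (k ↑ʳ_))))

indicator : ∀ {ℓ} {P : Set ℓ} → Dec P → ℕ
indicator (yes _) = 1
indicator (no _) = 0

δ : ℕ → ℕ → ℕ
δ a c = indicator (a ≟ c)

δ-refl : ∀ a → δ a a ≡ 1
δ-refl a with a ≟ a
... | yes _ = refl
... | no a≢a = ⊥-elim (a≢a refl)

δ-≡ : ∀ {a c} → a ≡ c → δ a c ≡ 1
δ-≡ {a} refl = δ-refl a

δ-≢ : ∀ {a c} → a ≢ c → δ a c ≡ 0
δ-≢ {a} {c} a≢c with a ≟ c
... | yes a≡c = ⊥-elim (a≢c a≡c)
... | no _ = refl

δ≡1 : ∀ {a c} → δ a c ≡ 1 → a ≡ c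
δ≡1 {a} {c} δ≡ with a ≟ c
... | yes a≡c = a≡c
... | no _ = ⊥-elim (0≢1+n δ≡)

δ≤1 : ∀ a c → δ a c ≤ 1
δ≤1 a c with a ≟ c
... | yes _ = s≤s z≤n
... | no _ = z≤n

δ-two : ∀ a {u v} → u ≢ v → δ a u + δ a v ≤ 1
δ-two a {u} {v} u≢v with a ≟ u | a ≟ v
... | yes refl | yes refl = ⊥-elim (u≢v refl)
... | yes _ | no _ = s≤s z≤n
... | no _ | yes _ = s≤s z≤n
... | no _ | no _ = z≤n

exclusive : ∀ {a b} → a ≤ 1 → b ≤ 1 → (a ≡ 1 → b ≡ 1 → ⊥) → a + b ≤ 1
exclusive z≤n b≤1 _ = b≤1
exclusive (s≤s z≤n) z≤n _ = s≤s z≤n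
exclusive (s≤s z≤n) (s≤s z≤n) both = ⊥-elim (both refl refl)

bit-zero : ∀ {a} → a ≤ 1 → (a ≡ 1 → ⊥) → a ≡ 0
bit-zero z≤n _ = refl
bit-zero (s≤s z≤n) a≢1 = ⊥-elim (a≢1 refl)

exclusive4 : ∀ {a b c d} → a ≤ 1 → b ≤ 1 → c ≤ 1 → d ≤ 1 →
  a + b ≤ 1 → a + c ≤ 1 → a + d ≤ 1 → b + c ≤ 1 → b + d ≤ 1 → c + d ≤ 1 → a + b + c + d ≤ 1
exclusive4 z≤n z≤n z≤n d≤1 _ _ _ _ _ _ = d≤1
exclusive4 z≤n z≤n (s≤s z≤n) z≤n _ _ _ _ _ _ = s≤s z≤n
exclusive4 z≤n (s≤s z≤n) z≤n z≤n _ _ _ _ _ _ = s≤s z≤n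
exclusive4 (s≤s z≤n) z≤n z≤n z≤n _ _ _ _ _ _ = s≤s z≤n
exclusive4 z≤n z≤n (s≤s z≤n) (s≤s z≤n) _ _ _ _ _ (s≤s ())
exclusive4 z≤n (s≤s z≤n) _ (s≤s z≤n) _ _ _ _ (s≤s ()) _
exclusive4 z≤n (s≤s z≤n) (s≤s z≤n) z≤n _ _ _ (s≤s ()) _ _
exclusive4 (s≤s z≤n) _ _ (s≤s z≤n) _ _ (s≤s ()) _ _ _
exclusive4 (s≤s z≤n) _ (s≤s z≤n) z≤n _ (s≤s ()) _ _ _ _
exclusive4 (s≤s z≤n) (s≤s z≤n) z≤n z≤n (s≤s ()) _ _ _ _ _

length-filter : ∀ {k} {A : Set} {P : Pred A 0ℓ} (P? : Decidable P) (g : Fin k → A) →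
  length (filter P? (tabulate g)) ≡ sum (λ i → indicator (P? (g i)))
length-filter {zero} P? g = refl
length-filter {suc k} P? g with P? (g zero)
... | yes _ = cong suc (length-filter P? (g ∘ suc))
... | no _ = length-filter P? (g ∘ suc)

-- A property of colours holding above K either holds everywhere or has an
-- explicit counterexample (only the colours ≤ K need to be inspected).
decide-bounded : ∀ K {P : ℕ → Set} → (∀ c → Dec (P c)) → (∀ c → K < c → P c) →
  (∀ c → P c) ⊎ ∃ (λ c → ¬ P c)
decide-bounded K {P} P? above with all? (λ (i : Fin (suc K)) → P? (toℕ i))
... | no ¬all = let (i , ¬Pi) = ¬∀⟶∃¬ (suc K) (P ∘ toℕ) (P? ∘ toℕ) ¬all in inj₂ (toℕ i , ¬Pi)
... | yes all = inj₁ everywhere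
  where
  everywhere : ∀ c → P c
  everywhere c with c ≤? K
  ... | yes c≤K = subst P (toℕ-fromℕ< (s≤s c≤K)) (all (fromℕ< (s≤s c≤K)))
  ... | no c≰K = above c (≰⇒> c≰K)

ceilHalf≡ : ∀ N → ceilDiv N 2 ≡ suc N / 2
ceilHalf≡ N = cong (λ t → (t ∸ 1) / 2) (+-comm N 2)

ceilHalf-intro : ∀ N a → a * 2 ≤ suc N → a ≤ ceilDiv N 2
ceilHalf-intro N a 2a≤ rewrite ceilHalf≡ N = subst (_≤ suc N / 2) (m*n/n≡m a 2) (/-monoˡ-≤ 2 2a≤)

ceilHalf-elim : ∀ N a → a ≤ ceilDiv N 2 → a * 2 ≤ suc N
ceilHalf-elim N a a≤ rewrite ceilHalf≡ N = ≤-trans (*-monoˡ-≤ 2 a≤) (m/n*n≤m (suc N) 2)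

*2≡+ : ∀ a → a * 2 ≡ a + a
*2≡+ = solve-∀

ceilHalf-covers : ∀ N → N ≤ ceilDiv N 2 + ceilDiv N 2
ceilHalf-covers N with N ≤? ceilDiv N 2 * 2
... | yes N≤ = subst (N ≤_) (*2≡+ (ceilDiv N 2)) N≤
... | no N≰ = ⊥-elim (n≮n _ (ceilHalf-intro N (suc (ceilDiv N 2)) (s≤s (≰⇒> N≰))))

-- The admissible colours of a vertex once its neighbours' constraints are
-- known: either one forced colour, or a free choice between two colours.
data Option : Set where
  forced : ℕ → Option
  either : (u v : ℕ) → u ≢ v → Option

Allows : Option → ℕ → Set
Allows (forced w) h = h ≡ w
Allows (either u v _) h = h ≡ u ⊎ h ≡ v

forces : Option → ℕ → ℕ
forces (forced w) c = δ w c
forces (either _ _ _) c = 0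

forces≤1 : ∀ o c → forces o c ≤ 1
forces≤1 (forced w) c = δ≤1 w c
forces≤1 (either _ _ _) c = z≤n

forcedCount : ∀ {M} → (Fin M → Option) → ℕ → ℕ
forcedCount os c = sum (λ i → forces (os i) c)

-- Each item is forced to at most one of two distinct colours.
forcedCount-pair : ∀ {M} (os : Fin M → Option) {u v} → u ≢ v → forcedCount os u + forcedCount os v ≤ M
forcedCount-pair os {u} {v} u≢v =
  subst (_≤ _) (∑-distrib-+ (λ i → forces (os i) u) (λ i → forces (os i) v))
    (sum-≤-card _ (λ i → one-of (os i)))
  where
  one-of : ∀ o → forces o u + forces o v ≤ 1
  one-of (forced w) = δ-two w u≢v
  one-of (either _ _ _) = z≤n

occurrences : ∀ {M} → (Fin M → ℕ) → ℕ → ℕ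
occurrences h c = sum (λ i → δ (h i) c)

addColour : (ℕ → ℕ) → ℕ → (ℕ → ℕ)
addColour load w c = load c + δ w c

Room : ∀ {M} → ℕ → (Fin M → Option) → (ℕ → ℕ) → Set
Room K os load = ∀ c → load c + forcedCount os c ≤ K

PairRoom : ℕ → ℕ → (ℕ → ℕ) → Set
PairRoom K M load = ∀ u v → u ≢ v → load u + load v + M ≤ K + K

-- The first item has an admissible colour with spare room.  For a free item
-- this is where PairRoom is needed: the two candidates cannot both be full.
first-colour : ∀ {K M} (o : Option) (os : Fin M → Option) (load : ℕ → ℕ) →
  (∀ c → load c + (forces o c + forcedCount os c) ≤ K) → PairRoom K (suc M) load →
  Σ ℕ λ w → Allows o w × load w + forcedCount os w < K
first-colour {K} (forced w) os load room _ = w , refl , subst (_≤ K) w-is-forced (room w)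
  where
  w-is-forced : load w + (δ w w + forcedCount os w) ≡ suc (load w + forcedCount os w)
  w-is-forced = trans (cong (λ t → load w + (t + forcedCount os w)) (δ-refl w)) (+-suc (load w) _)
first-colour {K} {M} (either u v u≢v) os load room pairRoom
  with load u + forcedCount os u <? K | load v + forcedCount os v <? K
... | yes spare | _ = u , inj₁ refl , spare
... | no _ | yes spare = v , inj₂ refl , spare
... | no full-u | no full-v = ⊥-elim (n≮n (K + K) (begin-strict
  K + K                                                   ≤⟨ +-mono-≤ (≮⇒≥ full-u) (≮⇒≥ full-v) ⟩
  load u + forcedCount os u + (load v + forcedCount os v) ≡⟨ +-interchange (load u) _ (load v) _ ⟩
  load u + load v + (forcedCount os u + forcedCount os v) <⟨ +-monoʳ-< (load u + load v) (s≤s (forcedCount-pair os u≢v)) ⟩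
  load u + load v + suc M                                 ≤⟨ pairRoom u v u≢v ⟩
  K + K                                                   ∎))
  where open ≤-Reasoning

room-add : ∀ {K M} (os : Fin M → Option) load w →
  (∀ c → load c + forcedCount os c ≤ K) → load w + forcedCount os w < K → Room K os (addColour load w)
room-add {K} os load w room spare c with w ≟ c
... | yes refl = subst (_≤ K) (cong (_+ forcedCount os w) (sym (+-comm (load w) 1))) spare
... | no _ = subst (_≤ K) (cong (_+ forcedCount os c) (sym (+-identityʳ (load c)))) (room c)

pairRoom-add : ∀ {K M} load w → PairRoom K (suc M) load → PairRoom K M (addColour load w)
pairRoom-add {K} {M} load w pairRoom u v u≢v = begin
  load u + δ w u + (load v + δ w v) + M   ≡⟨ cong (_+ M) (+-interchange (load u) (δ w u) (load v) (δ w v)) ⟩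
  load u + load v + (δ w u + δ w v) + M   ≤⟨ +-monoˡ-≤ M (+-monoʳ-≤ (load u + load v) (δ-two w u≢v)) ⟩
  load u + load v + 1 + M                 ≡⟨ +-assoc (load u + load v) 1 M ⟩
  load u + load v + suc M                 ≤⟨ pairRoom u v u≢v ⟩
  K + K                                   ∎
  where open ≤-Reasoning

greedy : ∀ K M (os : Fin M → Option) (load : ℕ → ℕ) → Room K os load → PairRoom K M load →
  Σ (Fin M → ℕ) λ h → (∀ i → Allows (os i) (h i)) × (∀ c → load c + occurrences h c ≤ K)
greedy K zero os load room _ = (λ ()) , (λ ()) , room
greedy K (suc M) os load room pairRoom =
  let (w , allowed , spare) = first-colour (os zero) (os ∘ suc) load room pairRoom
      room-rest : ∀ c → load c + forcedCount (os ∘ suc) c ≤ K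
      room-rest c = ≤-trans (+-monoʳ-≤ (load c) (m≤n+m _ _)) (room c)
      (h , allows , fits) = greedy K M (os ∘ suc) (addColour load w)
                              (room-add (os ∘ suc) load w room-rest spare) (pairRoom-add {K} load w pairRoom)
  in (λ { zero → w ; (suc i) → h i }) ,
     (λ { zero → allowed ; (suc i) → allows i }) ,
     (λ c → subst (_≤ K) (+-assoc (load c) (δ w c) _) (fits c))

record Pair : Set where
  constructor mkPair
  field
    fst snd : ℕ
    distinct : fst ≢ snd
open Pair public

pick : Bool → Pair → ℕ
pick true P = fst P
pick false P = snd P

pick-∈ : ∀ b P → pick b P ∈ fst P ∷ snd P ∷ []
pick-∈ true P = here refl
pick-∈ false P = there (here refl)

leafOption : ℕ → Pair → Option
leafOption x (mkPair a b a≢b) with a ≟ x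
... | yes _ = forced b
... | no _ with b ≟ x
...   | yes _ = forced a
...   | no _ = either a b a≢b

IsList : Pair → ℕ → ℕ → Set
IsList P x c = (fst P ≡ x × snd P ≡ c) ⊎ (snd P ≡ x × fst P ≡ c)

leaf-forces : ∀ x P c → forces (leafOption x P) c ≡ 1 → IsList P x c
leaf-forces x (mkPair a b a≢b) c forced-c with a ≟ x
... | yes a≡x = inj₁ (a≡x , δ≡1 forced-c)
... | no _ with b ≟ x
...   | yes b≡x = inj₂ (b≡x , δ≡1 forced-c)
...   | no _ = ⊥-elim (0≢1+n forced-c)

leaf-allowed : ∀ x P h → Allows (leafOption x P) h → h ≢ x × (h ≡ fst P ⊎ h ≡ snd P)
leaf-allowed x (mkPair a b a≢b) h allowed with a ≟ x
... | yes refl = (λ h≡a → a≢b (trans (sym h≡a) allowed)) , inj₂ allowed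
... | no a≢x with b ≟ x
...   | yes refl = (λ h≡b → a≢b (trans (sym allowed) h≡b)) , inj₁ allowed
...   | no b≢x with allowed
...     | inj₁ refl = a≢x , inj₁ refl
...     | inj₂ refl = b≢x , inj₂ refl

SamePair : ℕ → ℕ → ℕ → ℕ → Set
SamePair x c x' c' = (x ≡ x' × c ≡ c') ⊎ (x ≡ c' × c ≡ x')

distinct-pairs : ∀ {x c x' c'} → (x ≢ x' ⊎ c ≢ c') → (x ≢ c' ⊎ c ≢ x') → ¬ SamePair x c x' c'
distinct-pairs (inj₁ x≢x') _ (inj₁ (x≡x' , _)) = x≢x' x≡x'
distinct-pairs (inj₂ c≢c') _ (inj₁ (_ , c≡c')) = c≢c' c≡c'
distinct-pairs _ (inj₁ x≢c') (inj₂ (x≡c' , _)) = x≢c' x≡c'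
distinct-pairs _ (inj₂ c≢x') (inj₂ (_ , c≡x')) = c≢x' c≡x'

leaf-exclusive : ∀ P {x c x' c'} → ¬ SamePair x c x' c' →
  forces (leafOption x P) c + forces (leafOption x' P) c' ≤ 1
leaf-exclusive P {x} {c} {x'} {c'} different =
  exclusive (forces≤1 (leafOption x P) c) (forces≤1 (leafOption x' P) c')
    (λ f f' → different (same (leaf-forces x P c f) (leaf-forces x' P c' f')))
  where
  same : IsList P x c → IsList P x' c' → SamePair x c x' c'
  same (inj₁ (p , q)) (inj₁ (p' , q')) = inj₁ (trans (sym p) p' , trans (sym q) q')
  same (inj₁ (p , q)) (inj₂ (p' , q')) = inj₂ (trans (sym p) q' , trans (sym q) p')
  same (inj₂ (p , q)) (inj₁ (p' , q')) = inj₂ (trans (sym p) q' , trans (sym q) p')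
  same (inj₂ (p , q)) (inj₂ (p' , q')) = inj₁ (trans (sym p) p' , trans (sym q) q')

leaf-not-centre : ∀ x P → forces (leafOption x P) x ≡ 0
leaf-not-centre x P = bit-zero (forces≤1 (leafOption x P) x) (λ f → no-loop (leaf-forces x P x f))
  where
  no-loop : ¬ IsList P x x
  no-loop (inj₁ (p , q)) = distinct P (trans p (sym q))
  no-loop (inj₂ (p , q)) = distinct P (trans q (sym p))

record Star (m : ℕ) : Set where
  constructor mkStar
  field
    centre : Pair
    leaf : Fin m → Pair
open Star public

centreColour : ∀ {m} → Star m → Bool → ℕ
centreColour S b = pick b (centre S)

α : ∀ {m} → Star m → ℕ → ℕ → ℕ
α S x c = sum (λ p → forces (leafOption x (leaf S p)) c)

-- φ S b c: number of vertices of S forced to c when the centre gets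
-- centreColour S b (the centre itself counts as forced).
φ : ∀ {m} → Star m → Bool → ℕ → ℕ
φ S b c = δ (centreColour S b) c + α S (centreColour S b) c

α≤m : ∀ {m} (S : Star m) x c → α S x c ≤ m
α≤m S x c = sum-≤-card _ (λ p → forces≤1 (leafOption x (leaf S p)) c)

-- Different pairs {x, c} ≠ {x', c'} are served by different leaves.
α-disjoint : ∀ {m} (S : Star m) {x c x' c'} → ¬ SamePair x c x' c' → α S x c + α S x' c' ≤ m
α-disjoint {m} S {x} {c} {x'} {c'} different =
  subst (_≤ m) (∑-distrib-+ (λ p → forces (leafOption x (leaf S p)) c) (λ p → forces (leafOption x' (leaf S p)) c'))
    (sum-≤-card _ (λ p → leaf-exclusive (leaf S p) different))

-- The four pairs {pᵢ, qⱼ} are served by different leaves.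
α-four : ∀ {m} (S : Star m) {p₁ p₂ q₁ q₂} → p₁ ≢ p₂ → q₁ ≢ q₂ →
  p₁ ≢ q₁ → p₁ ≢ q₂ → p₂ ≢ q₁ → p₂ ≢ q₂ →
  α S p₁ q₁ + α S p₁ q₂ + α S p₂ q₁ + α S p₂ q₂ ≤ m
α-four {m} S {p₁} {p₂} {q₁} {q₂} p₁≢p₂ q₁≢q₂ p₁≢q₁ p₁≢q₂ p₂≢q₁ p₂≢q₂ =
  subst (_≤ m) total (sum-≤-card _ per-leaf)
  where
  f : ℕ → ℕ → Fin _ → ℕ
  f x c p = forces (leafOption x (leaf S p)) c
  per-leaf : ∀ p → f p₁ q₁ p + f p₁ q₂ p + f p₂ q₁ p + f p₂ q₂ p ≤ 1
  per-leaf p = exclusive4 (bit p₁ q₁) (bit p₁ q₂) (bit p₂ q₁) (bit p₂ q₂)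
    (leaf-exclusive P (distinct-pairs (inj₂ q₁≢q₂) (inj₁ p₁≢q₂)))
    (leaf-exclusive P (distinct-pairs (inj₁ p₁≢p₂) (inj₁ p₁≢q₁)))
    (leaf-exclusive P (distinct-pairs (inj₁ p₁≢p₂) (inj₁ p₁≢q₂)))
    (leaf-exclusive P (distinct-pairs (inj₁ p₁≢p₂) (inj₁ p₁≢q₁)))
    (leaf-exclusive P (distinct-pairs (inj₁ p₁≢p₂) (inj₁ p₁≢q₂)))
    (leaf-exclusive P (distinct-pairs (inj₂ q₁≢q₂) (inj₁ p₂≢q₂)))
    where
    P : Pair
    P = leaf S p
    bit : ∀ x c → forces (leafOption x P) c ≤ 1
    bit x c = forces≤1 (leafOption x P) c
  total : sum (λ p → f p₁ q₁ p + f p₁ q₂ p + f p₂ q₁ p + f p₂ q₂ p)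
        ≡ α S p₁ q₁ + α S p₁ q₂ + α S p₂ q₁ + α S p₂ q₂
  total = trans (∑-distrib-+ (λ p → f p₁ q₁ p + f p₁ q₂ p + f p₂ q₁ p) (f p₂ q₂))
    (cong (_+ α S p₂ q₂) (trans (∑-distrib-+ (λ p → f p₁ q₁ p + f p₁ q₂ p) (f p₂ q₁))
      (cong (_+ α S p₂ q₁) (∑-distrib-+ (f p₁ q₁) (f p₁ q₂)))))

φ-centre : ∀ {m} (S : Star m) b → φ S b (centreColour S b) ≡ 1
φ-centre S b = cong₂ _+_ (δ-refl x) (sum-zeros _ (λ p → leaf-not-centre x (leaf S p)))
  where
  x : ℕ
  x = centreColour S b

φ-off-centre : ∀ {m} (S : Star m) b {c} → c ≢ centreColour S b → φ S b c ≡ α S (centreColour S b) c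
φ-off-centre S b c≢x = cong (_+ α S (centreColour S b) _) (δ-≢ (c≢x ∘ sym))

φ≤m : ∀ {m} → 1 ≤ m → (S : Star m) → ∀ b c → φ S b c ≤ m
φ≤m {m} 1≤m S b c with c ≟ centreColour S b
... | yes refl = subst (_≤ m) (sym (φ-centre S b)) 1≤m
... | no c≢x = subst (_≤ m) (sym (φ-off-centre S b c≢x)) (α≤m S _ c)

bound : ∀ {m} → Star m → ℕ
bound S = fst (centre S) + snd (centre S) + sum (λ p → fst (leaf S p) + snd (leaf S p))

φ-above-bound : ∀ {m} (S : Star m) b c → bound S < c → φ S b c ≡ 0
φ-above-bound S b c big = cong₂ _+_ (δ-≢ x≢c) (sum-zeros _ leaf-not-c)
  where
  x : ℕ
  x = centreColour S b
  x≤bound : x ≤ bound S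
  x≤bound = ≤-trans (pick≤ b (centre S)) (m≤m+n _ _)
    where
    pick≤ : ∀ b P → pick b P ≤ fst P + snd P
    pick≤ true P = m≤m+n _ _
    pick≤ false P = m≤n+m _ _
  x≢c : x ≢ c
  x≢c refl = <⇒≱ big x≤bound
  leaf-not-c : ∀ p → forces (leafOption x (leaf S p)) c ≡ 0
  leaf-not-c p = bit-zero (forces≤1 (leafOption x P) c) (λ f → too-big (leaf-forces x P c f))
    where
    P : Pair
    P = leaf S p
    P≤bound : fst P + snd P ≤ bound S
    P≤bound = ≤-trans (term≤sum (λ p → fst (leaf S p) + snd (leaf S p)) p) (m≤n+m _ _)
    too-big : ¬ IsList P x c
    too-big (inj₁ (_ , refl)) = <⇒≱ big (≤-trans (m≤n+m _ _) P≤bound)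
    too-big (inj₂ (_ , refl)) = <⇒≱ big (≤-trans (m≤m+n _ _) P≤bound)

Good : ∀ {m} → Star m → Star m → Bool → Bool → Set
Good {m} A B i j = ∀ c → φ A i c + φ B j c ≤ suc m

record Overloaded {m} (A B : Star m) (x y c : ℕ) : Set where
  constructor overloaded
  field
    not-x : c ≢ x
    not-y : c ≢ y
    excess : suc m < α A x c + α B y c
open Overloaded public

overloaded-swap : ∀ {m} {A B : Star m} {x y c} → Overloaded A B x y c → Overloaded B A y x c
overloaded-swap {m} {A} {B} {x} {y} {c} (overloaded c≢x c≢y over) = overloaded c≢y c≢x (subst (suc m <_) (+-comm (α A x c) _) over)

good-above-bound : ∀ {m} (A B : Star m) i j c → bound A + bound B < c → φ A i c + φ B j c ≤ suc m
good-above-bound A B i j c big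
  rewrite φ-above-bound A i c (≤-<-trans (m≤m+n _ _) big)
        | φ-above-bound B j c (≤-<-trans (m≤n+m (bound B) (bound A)) big) = z≤n

-- A colour violating goodness is not a centre colour (a centre colour is
-- forced once in its own star and at most m times in the other), so it is
-- overloaded by leaves alone.
violation-overloaded : ∀ {m} → 1 ≤ m → (A B : Star m) → ∀ i j c →
  ¬ (φ A i c + φ B j c ≤ suc m) → Overloaded A B (centreColour A i) (centreColour B j) c
violation-overloaded {m} 1≤m A B i j c bad with c ≟ centreColour A i | c ≟ centreColour B j
... | yes refl | _ = ⊥-elim (bad (subst (λ t → t + φ B j c ≤ suc m) (sym (φ-centre A i)) (s≤s (φ≤m 1≤m B j c))))
... | no _ | yes refl = ⊥-elim (bad (subst (λ t → φ A i c + t ≤ suc m) (sym (φ-centre B j))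
                                      (subst (_≤ suc m) (+-comm 1 _) (s≤s (φ≤m 1≤m A i c)))))
... | no c≢x | no c≢y = overloaded c≢x c≢y (subst₂ (λ a b → suc m < a + b) (φ-off-centre A i c≢x) (φ-off-centre B j c≢y) (≰⇒> bad))

good-or-overloaded : ∀ {m} → 1 ≤ m → (A B : Star m) → ∀ i j →
  Good A B i j ⊎ ∃ (Overloaded A B (centreColour A i) (centreColour B j))
good-or-overloaded {m} 1≤m A B i j
  with decide-bounded (bound A + bound B) (λ c → φ A i c + φ B j c ≤? suc m) (good-above-bound A B i j)
... | inj₁ good = inj₁ good
... | inj₂ (c , bad) = inj₂ (c , violation-overloaded 1≤m A B i j c bad)

-- Two overloads (a + b > m + 1 and a' + b' > m + 1) cannot draw on the same
-- m leaves of each star (a + a' ≤ m and b + b' ≤ m).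
two-overloads : ∀ {m a b a' b'} → suc m < a + b → suc m < a' + b' → a + a' ≤ m → b + b' ≤ m → ⊥
two-overloads {m} {a} {b} {a'} {b'} over over' aa' bb' = m+1+n≰m (m + m) (begin
  m + m + 4                  ≡⟨ regroup-m m ⟩
  suc (suc m) + suc (suc m)  ≤⟨ +-mono-≤ over over' ⟩
  a + b + (a' + b')          ≡⟨ +-interchange a b a' b' ⟩
  a + a' + (b + b')          ≤⟨ +-mono-≤ aa' bb' ⟩
  m + m                      ∎)
  where
  open ≤-Reasoning
  regroup-m : ∀ m → m + m + 4 ≡ suc (suc m) + suc (suc m)
  regroup-m = solve-∀

overloads-agree : ∀ {m} {A B : Star m} {x y₁ y₂ c c'} → y₁ ≢ y₂ →
  Overloaded A B x y₁ c → Overloaded A B x y₂ c' → c ≡ c' ⊎ (c ≡ y₂ × c' ≡ y₁)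
overloads-agree {A = A} {B} {x} {y₁} {y₂} {c} {c'} y₁≢y₂ (overloaded c≢x _ over) (overloaded c'≢x _ over')
  with c ≟ c'
... | yes c≡c' = inj₁ c≡c'
... | no c≢c' = crossed-or-clash (c ≟ y₂) (y₁ ≟ c')
  where
  clash : (y₁ ≢ c' ⊎ c ≢ y₂) → ⊥
  clash cross = two-overloads {a = α A x c} {α B y₁ c} {α A x c'} {α B y₂ c'} over over'
    (α-disjoint A (distinct-pairs (inj₂ c≢c') (inj₁ (c'≢x ∘ sym))))
    (α-disjoint B (distinct-pairs (inj₁ y₁≢y₂) cross))
  crossed-or-clash : Dec (c ≡ y₂) → Dec (y₁ ≡ c') → c ≡ c' ⊎ (c ≡ y₂ × c' ≡ y₁)
  crossed-or-clash (yes c≡y₂) (yes y₁≡c') = inj₂ (c≡y₂ , sym y₁≡c')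
  crossed-or-clash (no c≢y₂) _ = ⊥-elim (clash (inj₂ c≢y₂))
  crossed-or-clash (yes _) (no y₁≢c') = ⊥-elim (clash (inj₁ y₁≢c'))

common-overload : ∀ {m} {A B : Star m} {x₁ x₂ y₁ y₂ c} → x₁ ≢ x₂ → y₁ ≢ y₂ →
  Overloaded A B x₁ y₁ c → Overloaded A B x₂ y₂ c → ⊥
common-overload {A = A} {B} {x₁} {x₂} {y₁} {y₂} {c} x₁≢x₂ y₁≢y₂ (overloaded c≢x₁ c≢y₁ over) (overloaded _ _ over') =
  two-overloads {a = α A x₁ c} {α B y₁ c} {α A x₂ c} {α B y₂ c} over over'
    (α-disjoint A (distinct-pairs (inj₁ x₁≢x₂) (inj₁ (c≢x₁ ∘ sym))))
    (α-disjoint B (distinct-pairs (inj₁ y₁≢y₂) (inj₁ (c≢y₁ ∘ sym))))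

-- The arithmetic behind `crossed-overload`: four overloads need 4(m+2)
-- forced leaves, but at most 4m + m ≤ 4m + 7 are available.
four-overloads : ∀ {m a a' b₁ b₂ b₃ b₄} → m ≤ 7 → a ≤ m → a' ≤ m → b₁ + b₃ + b₂ + b₄ ≤ m →
  suc m < a + b₁ → suc m < a + b₂ → suc m < a' + b₃ → suc m < a' + b₄ → ⊥
four-overloads {m} {a} {a'} {b₁} {b₂} {b₃} {b₄} m≤7 a≤m a'≤m b≤m o₁ o₂ o₃ o₄ = m+1+n≰m (m * 4 + 7) (begin
  m * 4 + 7 + 1                                          ≡⟨ regroup-m m ⟩
  suc (suc m) + suc (suc m) + suc (suc m) + suc (suc m)  ≤⟨ +-mono-≤ (+-mono-≤ (+-mono-≤ o₁ o₂) o₃) o₄ ⟩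
  (a + b₁) + (a + b₂) + (a' + b₃) + (a' + b₄)            ≡⟨ regroup a a' b₁ b₂ b₃ b₄ ⟩
  (a + a) + (a' + a') + (b₁ + b₃ + b₂ + b₄)              ≤⟨ +-mono-≤ (+-mono-≤ (+-mono-≤ a≤m a≤m) (+-mono-≤ a'≤m a'≤m)) b≤m ⟩
  (m + m) + (m + m) + m                                  ≡⟨ regroup-5m m ⟩
  m * 4 + m                                              ≤⟨ +-monoʳ-≤ (m * 4) m≤7 ⟩
  m * 4 + 7                                              ∎)
  where
  open ≤-Reasoning
  regroup-m : ∀ m → m * 4 + 7 + 1 ≡ suc (suc m) + suc (suc m) + suc (suc m) + suc (suc m)
  regroup-m = solve-∀
  regroup : ∀ a a' b₁ b₂ b₃ b₄ → (a + b₁) + (a + b₂) + (a' + b₃) + (a' + b₄) ≡ (a + a) + (a' + a') + (b₁ + b₃ + b₂ + b₄)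
  regroup = solve-∀
  regroup-5m : ∀ m → (m + m) + (m + m) + m ≡ m * 4 + m
  regroup-5m = solve-∀

-- The crossed configuration: A's centre x₁ overloads x₂ and A's centre x₂
-- overloads x₁, for both centres y₁, y₂ of B.  A supplies at most m leaves
-- to each, and the four pairs {yⱼ, xᵢ} share the m leaves of B: this needs
-- m ≥ 8.
crossed-overload : ∀ {m} → m ≤ 7 → (A B : Star m) → ∀ {x₁ x₂ y₁ y₂} → x₁ ≢ x₂ → y₁ ≢ y₂ →
  Overloaded A B x₁ y₁ x₂ → Overloaded A B x₁ y₂ x₂ → Overloaded A B x₂ y₁ x₁ → Overloaded A B x₂ y₂ x₁ → ⊥
crossed-overload m≤7 A B {x₁} {x₂} {y₁} {y₂} x₁≢x₂ y₁≢y₂ (overloaded _ x₂≢y₁ o₁) (overloaded _ x₂≢y₂ o₂) (overloaded _ x₁≢y₁ o₃) (overloaded _ x₁≢y₂ o₄) =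
  four-overloads m≤7 (α≤m A x₁ x₂) (α≤m A x₂ x₁)
    (α-four B y₁≢y₂ (x₁≢x₂ ∘ sym) (x₂≢y₁ ∘ sym) (x₁≢y₁ ∘ sym) (x₂≢y₂ ∘ sym) (x₁≢y₂ ∘ sym))
    o₁ o₂ o₃ o₄

-- Comparing the overloaded colours along rows and columns (`overloads-agree`)
-- leaves only the common and the two crossed configurations.
no-overloaded-square : ∀ {m} → m ≤ 7 → (A B : Star m) → ∀ {x₁ x₂ y₁ y₂ c₁₁ c₁₂ c₂₁ c₂₂} → x₁ ≢ x₂ → y₁ ≢ y₂ →
  Overloaded A B x₁ y₁ c₁₁ → Overloaded A B x₁ y₂ c₁₂ → Overloaded A B x₂ y₁ c₂₁ → Overloaded A B x₂ y₂ c₂₂ → ⊥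
no-overloaded-square m≤7 A B x₁≢x₂ y₁≢y₂ o₁₁ o₁₂ o₂₁ o₂₂
  with overloads-agree y₁≢y₂ o₁₁ o₁₂ | overloads-agree y₁≢y₂ o₂₁ o₂₂
     | overloads-agree x₁≢x₂ (overloaded-swap o₁₁) (overloaded-swap o₂₁)
     | overloads-agree x₁≢x₂ (overloaded-swap o₁₂) (overloaded-swap o₂₂)
... | inj₁ refl | inj₁ refl | inj₁ refl | _ = common-overload x₁≢x₂ y₁≢y₂ o₁₁ o₂₂
... | inj₁ refl | inj₁ refl | inj₂ (refl , refl) | _ = crossed-overload m≤7 A B x₁≢x₂ y₁≢y₂ o₁₁ o₁₂ o₂₁ o₂₂
... | inj₂ (refl , refl) | inj₂ (refl , refl) | _ | _ =
  crossed-overload m≤7 B A y₁≢y₂ x₁≢x₂ (overloaded-swap o₁₁) (overloaded-swap o₂₁) (overloaded-swap o₁₂) (overloaded-swap o₂₂)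
... | inj₂ (refl , refl) | inj₁ refl | inj₁ refl | _ = not-y o₂₂ refl
... | inj₂ (refl , refl) | inj₁ refl | inj₂ (refl , refl) | inj₁ refl = not-x o₁₂ refl
... | inj₂ (refl , refl) | inj₁ refl | inj₂ (refl , refl) | inj₂ (refl , refl) = y₁≢y₂ refl
... | inj₁ refl | inj₂ (refl , refl) | inj₁ refl | _ = not-y o₁₂ refl
... | inj₁ refl | inj₂ (refl , refl) | inj₂ (refl , refl) | inj₁ refl = not-x o₂₂ refl
... | inj₁ refl | inj₂ (refl , refl) | inj₂ (refl , refl) | inj₂ (refl , refl) = y₁≢y₂ refl

two-star-lemma : ∀ {m} → 1 ≤ m → m ≤ 7 → (A B : Star m) → Σ Bool λ i → Σ Bool λ j → Good A B i j
two-star-lemma 1≤m m≤7 A B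
  with good-or-overloaded 1≤m A B true true | good-or-overloaded 1≤m A B true false
     | good-or-overloaded 1≤m A B false true | good-or-overloaded 1≤m A B false false
... | inj₁ good | _ | _ | _ = true , true , good
... | _ | inj₁ good | _ | _ = true , false , good
... | _ | _ | inj₁ good | _ = false , true , good
... | _ | _ | _ | inj₁ good = false , false , good
... | inj₂ (_ , o₁₁) | inj₂ (_ , o₁₂) | inj₂ (_ , o₂₁) | inj₂ (_ , o₂₂) =
  ⊥-elim (no-overloaded-square m≤7 A B (distinct (centre A)) (distinct (centre B)) o₁₁ o₁₂ o₂₁ o₂₂)

Φ : ∀ {n m} → (Fin n → Star m) → (Fin n → Bool) → ℕ → ℕ
Φ S b c = sum (λ j → φ (S j) (b j) c)

-- The centres can always be coloured so that no colour is forced more than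
-- ⌈n(m+1)/2⌉ times (stated as 2Φ ≤ n(m+1) + 1).
CentresChoosable : ℕ → ℕ → Set
CentresChoosable n m = (S : Fin n → Star m) → Σ (Fin n → Bool) λ b → ∀ c → Φ S b c * 2 ≤ suc (n * suc m)

paired-choice : ∀ {m} → 1 ≤ m → m ≤ 7 → ∀ k (S : Fin (k * 2) → Star m) →
  Σ (Fin (k * 2) → Bool) λ b → ∀ c → Φ S b c ≤ k * suc m
paired-choice 1≤m m≤7 zero S = (λ ()) , (λ _ → z≤n)
paired-choice {m} 1≤m m≤7 (suc k) S
  with two-star-lemma 1≤m m≤7 (S 0F) (S 1F) | paired-choice 1≤m m≤7 k (λ t → S (suc (suc t)))
... | i , j , good | b , fits = i Vector.∷ j Vector.∷ b , λ c →
  subst (_≤ suc k * suc m) (+-assoc (φ (S 0F) i c) (φ (S 1F) j c) (Φ (λ t → S (suc (suc t))) b c)) (+-mono-≤ (good c) (fits c))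

reassociate : ∀ k a → k * a * 2 ≡ k * 2 * a
reassociate = solve-∀

even-centres : ∀ {m} k → 1 ≤ m → m ≤ 7 → CentresChoosable (k * 2) m
even-centres {m} k 1≤m m≤7 S with paired-choice 1≤m m≤7 k S
... | b , fits = b , λ c → ≤-trans (*-monoˡ-≤ 2 (fits c)) (≤-trans (≤-reflexive (reassociate k (suc m))) (n≤1+n _))

-- For odd n the extra star forces each colour at most m times, and
-- 2m ≤ m + 2 exactly when m ≤ 2.
odd-centres : ∀ {m} k → 1 ≤ m → m ≤ 2 → CentresChoosable (suc (k * 2)) m
odd-centres {m} k 1≤m m≤2 S with paired-choice 1≤m (≤-trans m≤2 (s≤s (s≤s z≤n))) k (λ t → S (suc t))
... | b , fits = true Vector.∷ b , within-bound
  where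
  double≤ : ∀ {m} → m ≤ 2 → m * 2 ≤ 2 + m
  double≤ z≤n = z≤n
  double≤ (s≤s z≤n) = s≤s (s≤s z≤n)
  double≤ (s≤s (s≤s z≤n)) = ≤-refl
  within-bound : ∀ c → Φ S (true Vector.∷ b) c * 2 ≤ suc (suc (k * 2) * suc m)
  within-bound c = begin
    (φ (S 0F) true c + Φ (λ t → S (suc t)) b c) * 2    ≡⟨ *-distribʳ-+ 2 (φ (S 0F) true c) _ ⟩
    φ (S 0F) true c * 2 + Φ (λ t → S (suc t)) b c * 2  ≤⟨ +-mono-≤ (*-monoˡ-≤ 2 (φ≤m 1≤m (S 0F) true c)) (*-monoˡ-≤ 2 (fits c)) ⟩
    m * 2 + k * suc m * 2                              ≤⟨ +-mono-≤ (double≤ m≤2) (≤-reflexive (reassociate k (suc m))) ⟩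
    2 + m + k * 2 * suc m                              ∎
    where open ≤-Reasoning

as-pair : (l : List ℕ) → Unique l → length l ≡ 2 → Σ Pair λ P → l ≡ fst P ∷ snd P ∷ []
as-pair (a ∷ b ∷ []) ((a≢b ∷ []) ∷ _) refl = mkPair a b a≢b , refl

vertexOption : ∀ {m} → ℕ → Fin (suc m) → Pair → Option
vertexOption x zero _ = forced x
vertexOption x (suc _) P = leafOption x P

quotient-combine : ∀ {n k} (j : Fin n) (p : Fin k) → quotient k (combine j p) ≡ j
quotient-combine {n} {k} j p = cong proj₁ (remQuot-combine {n} {k} j p)

remainder-combine : ∀ {n k} (j : Fin n) (p : Fin k) → remainder {n} k (combine j p) ≡ p
remainder-combine {n} {k} j p = cong proj₂ (remQuot-combine {n} {k} j p)

by-position : ∀ {n m} {P : Fin (n * suc m) → Set} → (∀ (j : Fin n) (p : Fin (suc m)) → P (combine j p)) → ∀ v → P v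
by-position {n} {m} {P} at v = subst P (combine-remQuot {n} (suc m) v) (at (quotient {n} (suc m) v) (remainder {n} (suc m) v))

module Completion {n m : ℕ} (choose : CentresChoosable n m) (A : Assignment (starForest n m) 2) where

  cap : ℕ
  cap = ceilDiv (n * suc m) 2

  pair : Fin (n * suc m) → Pair
  pair v = proj₁ (as-pair (L A v) (unique A v) (size A v))

  stars : Fin n → Star m
  stars j = mkStar (pair (combine j 0F)) (λ p → pair (combine j (suc p)))

  choice : Fin n → Bool
  choice = proj₁ (choose stars)

  x : Fin n → ℕ
  x j = centreColour (stars j) (choice j)

  option : Fin (n * suc m) → Option
  option v = vertexOption (x (quotient (suc m) v)) (remainder {n} (suc m) v) (pair v)

  option-at : ∀ j p → option (combine j p) ≡ vertexOption (x j) p (pair (combine j p))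
  option-at j p rewrite quotient-combine {n} {suc m} j p | remainder-combine {n} {suc m} j p = refl

  forced-total : ∀ c → forcedCount option c ≡ Φ stars choice c
  forced-total c = trans (sum-combine n (suc m) (λ v → forces (option v) c))
    (sum-cong-≗ (λ j → sum-cong-≗ (λ p → cong (λ o → forces o c) (option-at j p))))

  room : Room cap option (λ _ → 0)
  room c = ceilHalf-intro (n * suc m) _ (subst (λ t → t * 2 ≤ _) (sym (forced-total c)) (proj₂ (choose stars) c))

  pairRoom : PairRoom cap (n * suc m) (λ _ → 0)
  pairRoom _ _ _ = ceilHalf-covers (n * suc m)

  completion : Σ (Fin (n * suc m) → ℕ) λ h → (∀ v → Allows (option v) (h v)) × (∀ c → 0 + occurrences h c ≤ cap)
  completion = greedy cap (n * suc m) option (λ _ → 0) room pairRoom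

  colour : Fin (n * suc m) → ℕ
  colour = proj₁ completion

  allowed-at : ∀ j p → Allows (vertexOption (x j) p (pair (combine j p))) (colour (combine j p))
  allowed-at j p = subst (λ o → Allows o (colour (combine j p))) (option-at j p) (proj₁ (proj₂ completion) (combine j p))

  in-list : ∀ v → colour v ∈ L A v
  in-list = by-position {n} {m} in-list-at
    where
    in-pair : ∀ v → colour v ∈ fst (pair v) ∷ snd (pair v) ∷ [] → colour v ∈ L A v
    in-pair v = subst (colour v ∈_) (sym (proj₂ (as-pair (L A v) (unique A v) (size A v))))
    in-list-at : ∀ (j : Fin n) (p : Fin (suc m)) → colour (combine j p) ∈ L A (combine j p)
    in-list-at j 0F = in-pair _ (subst (_∈ fst (pair (combine j 0F)) ∷ snd (pair (combine j 0F)) ∷ []) (sym (allowed-at j 0F))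
                                   (pick-∈ (choice j) (pair (combine j 0F))))
    in-list-at j (suc p) with proj₂ (leaf-allowed (x j) (pair (combine j (suc p))) _ (allowed-at j (suc p)))
    ... | inj₁ is-fst = in-pair _ (here is-fst)
    ... | inj₂ is-snd = in-pair _ (there (here is-snd))

  centre-colour : ∀ v → IsCenter (remainder {n} (suc m) v) → colour v ≡ x (quotient (suc m) v)
  centre-colour = by-position {n} {m} at
    where
    at : ∀ (j : Fin n) (p : Fin (suc m)) → IsCenter (remainder {n} (suc m) (combine j p)) →
         colour (combine j p) ≡ x (quotient (suc m) (combine j p))
    at j p rewrite quotient-combine {n} {suc m} j p | remainder-combine {n} {suc m} j p with p
    ... | 0F = λ _ → allowed-at j 0F
    ... | suc _ = λ ()

  leaf-colour : ∀ v → ¬ IsCenter (remainder {n} (suc m) v) → colour v ≢ x (quotient (suc m) v)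
  leaf-colour = by-position {n} {m} at
    where
    at : ∀ (j : Fin n) (p : Fin (suc m)) → ¬ IsCenter (remainder {n} (suc m) (combine j p)) →
         colour (combine j p) ≢ x (quotient (suc m) (combine j p))
    at j p rewrite quotient-combine {n} {suc m} j p | remainder-combine {n} {suc m} j p with p
    ... | 0F = λ not-centre → ⊥-elim (not-centre refl)
    ... | suc q = λ _ → proj₁ (leaf-allowed (x j) (pair (combine j (suc q))) _ (allowed-at j (suc q)))

  proper : ∀ u v → Adj (starForest n m) u v → colour u ≢ colour v
  proper u v (same-star , inj₁ (u-centre , v-leaf)) u≡v =
    leaf-colour v v-leaf (trans (sym u≡v) (trans (centre-colour u u-centre) (cong x same-star)))
  proper u v (same-star , inj₂ (u-leaf , v-centre)) u≡v =
    leaf-colour u u-leaf (trans u≡v (trans (centre-colour v v-centre) (cong x (sym same-star))))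

  balanced : ∀ c → colorCount colour c ≤ cap
  balanced c = subst (_≤ cap) (sym (length-filter (λ v → colour v ≟ c) (λ v → v))) (proj₂ (proj₂ completion) c)

  equitable : IsEquitableLColoring A colour
  equitable = (in-list , proper) , (λ c _ → balanced c)

sufficiency : ∀ n m → CentresChoosable n m → EquitablyChoosable (starForest n m) 2
sufficiency n m choose A = colour , equitable
  where open Completion choose A

pairAssignment : ∀ n m → (Fin n → Fin (suc m) → Pair) → Assignment (starForest n m) 2
pairAssignment n m lists = record
  { L = λ v → fst (P v) ∷ snd (P v) ∷ []
  ; unique = λ v → (distinct (P v) ∷ []) ∷ [] ∷ []
  ; size = λ _ → refl
  }
  where
  P : Fin (n * suc m) → Pair
  P v = lists (quotient (suc m) v) (remainder {n} (suc m) v)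

P01 : Pair
P01 = mkPair 0 1 (λ ())

two-coloured-star : ∀ {m a b} (s : Fin (suc m) → ℕ) → a ≢ b → s 0F ≡ a →
  (∀ p → s (suc p) ≡ a ⊎ s (suc p) ≡ b) → (∀ p → s 0F ≢ s (suc p)) →
  occurrences s a ≡ 1 × occurrences s b ≡ m
two-coloured-star {a = a} {b} s a≢b refl leaves proper =
  cong₂ _+_ (δ-refl a) (sum-zeros _ (λ p → δ-≢ (λ leaf≡a → proper p (sym leaf≡a)))) ,
  cong₂ _+_ (δ-≢ a≢b) (sum-ones _ (λ p → δ-≡ (leaf-is-b p)))
  where
  leaf-is-b : ∀ p → s (suc p) ≡ b
  leaf-is-b p with leaves p
  ... | inj₁ leaf≡a = ⊥-elim (proper p (sym leaf≡a))
  ... | inj₂ leaf≡b = leaf≡b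

binary-star : ∀ {m} (s : Fin (suc m) → ℕ) → (∀ p → s p ≡ 0 ⊎ s p ≡ 1) → (∀ p → s 0F ≢ s (suc p)) →
  (occurrences s 0 ≡ 1 × occurrences s 1 ≡ m) ⊎ (occurrences s 0 ≡ m × occurrences s 1 ≡ 1)
binary-star s in01 proper with in01 0F
... | inj₁ centre≡0 = inj₁ (two-coloured-star s (λ ()) centre≡0 (λ p → in01 (suc p)) proper)
... | inj₂ centre≡1 = inj₂ (×-swap (two-coloured-star s (λ ()) centre≡1 (λ p → ⊎-swap (in01 (suc p))) proper))

-- One more star of the second kind adds m to the first total.
shift : ∀ m a b → m + (a + m * b) ≡ a + m * suc b
shift = solve-∀

type-count : ∀ {k} m (u v : Fin k → ℕ) → (∀ j → (u j ≡ 1 × v j ≡ m) ⊎ (u j ≡ m × v j ≡ 1)) →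
  Σ ℕ λ p → Σ ℕ λ q → p + q ≡ k × sum u ≡ p + m * q × sum v ≡ q + m * p
type-count {zero} m u v _ = 0 , 0 , refl , sym (*-zeroʳ m) , sym (*-zeroʳ m)
type-count {suc k} m u v kinds with type-count m (λ j → u (suc j)) (λ j → v (suc j)) (λ j → kinds (suc j)) | kinds 0F
... | p , q , p+q , us , vs | inj₁ (u≡1 , v≡m) =
  suc p , q , cong suc p+q , cong₂ _+_ u≡1 us , trans (cong₂ _+_ v≡m vs) (shift m q p)
... | p , q , p+q , us , vs | inj₂ (u≡m , v≡1) =
  p , suc q , trans (+-suc p q) (cong suc p+q) , trans (cong₂ _+_ u≡m us) (shift m p q) , cong₂ _+_ v≡1 vs

module EquitableColouring (n m : ℕ) (lists : Fin n → Fin (suc m) → Pair) (f : Fin (n * suc m) → ℕ)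
                          (equitable : IsEquitableLColoring (pairAssignment n m lists) f) where

  colourAt : Fin n → Fin (suc m) → ℕ
  colourAt j p = f (combine j p)

  list-at : ∀ j p → L (pairAssignment n m lists) (combine j p) ≡ fst (lists j p) ∷ snd (lists j p) ∷ []
  list-at j p rewrite quotient-combine {n} {suc m} j p | remainder-combine {n} {suc m} j p = refl

  colour-in-list : ∀ j p → colourAt j p ≡ fst (lists j p) ⊎ colourAt j p ≡ snd (lists j p)
  colour-in-list j p with subst (f (combine j p) ∈_) (list-at j p) (proj₁ (proj₁ equitable) (combine j p))
  ... | here is-fst = inj₁ is-fst
  ... | there (here is-snd) = inj₂ is-snd

  centre≢leaf : ∀ j p → colourAt j 0F ≢ colourAt j (suc p)
  centre≢leaf j p = proj₂ (proj₁ equitable) (combine j 0F) (combine j (suc p)) adjacent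
    where
    adjacent : starAdj n m (combine j 0F) (combine j (suc p))
    adjacent rewrite quotient-combine {n} {suc m} j 0F | quotient-combine {n} {suc m} j (suc p)
                   | remainder-combine {n} {suc m} j 0F | remainder-combine {n} {suc m} j (suc p) =
      refl , inj₁ (refl , λ ())

  usage : ℕ → ℕ
  usage c = sum (λ j → occurrences (colourAt j) c)

  not-overloaded : ∀ c j p → c ∈ fst (lists j p) ∷ snd (lists j p) ∷ [] → ¬ (suc (suc (n * suc m)) ≤ usage c * 2)
  not-overloaded c j p c∈ too-many = n≮n _ (≤-trans too-many (ceilHalf-elim _ _ within))
    where
    within : usage c ≤ ceilDiv (n * suc m) 2
    within = subst (_≤ _) (trans (length-filter (λ v → f v ≟ c) (λ v → v)) (sum-combine n (suc m) (λ v → δ (f v) c)))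
               (proj₂ equitable c (combine j p , subst (c ∈_) (sym (list-at j p)) c∈))

  binary-stars : ∀ {k} (ι : Fin k → Fin n) → (∀ j p → lists (ι j) p ≡ P01) →
    Σ ℕ λ p → Σ ℕ λ q → p + q ≡ k × sum (λ j → occurrences (colourAt (ι j)) 0) ≡ p + m * q
                                  × sum (λ j → occurrences (colourAt (ι j)) 1) ≡ q + m * p
  binary-stars ι binary = type-count m _ _ (λ j → binary-star (colourAt (ι j)) (in01 j) (centre≢leaf (ι j)))
    where
    in01 : ∀ j p → colourAt (ι j) p ≡ 0 ⊎ colourAt (ι j) p ≡ 1
    in01 j p = subst (λ P → colourAt (ι j) p ≡ fst P ⊎ colourAt (ι j) p ≡ snd P) (binary j p) (colour-in-list (ι j) p)

majority : ∀ {p q} {X : Set} → p ≢ q → (p < q → X) → (q < p → X) → X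
majority {p} {q} p≢q less greater with <-cmp p q
... | tri< p<q _ _ = less p<q
... | tri≈ _ p≡q _ = ⊥-elim (p≢q p≡q)
... | tri> _ _ q<p = greater q<p

double-even : ∀ p → (p + p) % 2 ≡ 0
double-even p = trans (cong (_% 2) (sym (*2≡+ p))) (m*n%n≡0 p 2)

double-odd : ∀ p → suc (p + p) % 2 ≡ 1
double-odd p = trans (cong (λ t → suc t % 2) (sym (*2≡+ p))) ([m+kn]%n≡m%n 1 p 2)

-- With p < q and m ≥ 3, colour 0 in the odd construction exceeds ⌈N/2⌉.
odd-excess : ∀ {p q m} → p < q → 3 ≤ m → suc (suc ((p + q) * suc m)) ≤ (p + m * q) * 2
odd-excess {p} p<q 3≤m with m≤n⇒∃[o]m+o≡n p<q | m≤n⇒∃[o]m+o≡n 3≤m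
... | d , refl | e , refl = subst (suc (suc ((p + (suc p + d)) * suc (3 + e))) ≤_) (sym (identity p d e)) (m≤m+n _ _)
  where
  identity : ∀ p d e → (p + (3 + e) * (suc p + d)) * 2 ≡ suc (suc ((p + (suc p + d)) * suc (3 + e))) + (e + d * (2 + e))
  identity = solve-∀

-- With p < q, colour 0 in the even construction exceeds ⌈N/2⌉.
even-excess : ∀ {p q m} → p < q → 1 ≤ m → suc (suc (suc (p + q) * suc m)) ≤ (2 + (p + m * q)) * 2
even-excess {p} p<q 1≤m with m≤n⇒∃[o]m+o≡n p<q | m≤n⇒∃[o]m+o≡n 1≤m
... | d , refl | e , refl = subst (suc (suc (suc (p + (suc p + d)) * suc (1 + e))) ≤_) (sym (identity p d e)) (m≤m+n _ _)
  where
  identity : ∀ p d e → (2 + (p + (1 + e) * (suc p + d))) * 2 ≡ suc (suc (suc (p + (suc p + d)) * suc (1 + e))) + d * e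
  identity = solve-∀

odd-counterexample : ∀ n m → n % 2 ≡ 1 → 3 ≤ m → ¬ EquitablyChoosable (starForest n m) 2
odd-counterexample n@(suc _) m odd 3≤m choosable = no-equitable (choosable (pairAssignment n m binary))
  where
  binary : Fin n → Fin (suc m) → Pair
  binary _ _ = P01
  no-equitable : ∃ (IsEquitableLColoring (pairAssignment n m binary)) → ⊥
  no-equitable (f , equitable) =
    let (p , q , p+q≡n , zeros , ones) = binary-stars (λ j → j) (λ _ _ → refl)
        p≢q : p ≢ q
        p≢q = λ p≡q → 0≢1+n (begin
          0               ≡⟨ double-even p ⟨
          (p + p) % 2     ≡⟨ cong (λ t → (p + t) % 2) p≡q ⟩
          (p + q) % 2     ≡⟨ cong (_% 2) p+q≡n ⟩
          n % 2           ≡⟨ odd ⟩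
          1               ∎)
    in majority p≢q
         (λ p<q → not-overloaded 0 0F 0F (here refl)
            (subst₂ (λ k u → suc (suc (k * suc m)) ≤ u * 2) p+q≡n (sym zeros) (odd-excess p<q 3≤m)))
         (λ q<p → not-overloaded 1 0F 0F (there (here refl))
            (subst₂ (λ k u → suc (suc (k * suc m)) ≤ u * 2) (trans (+-comm q p) p+q≡n) (sym ones) (odd-excess q<p 3≤m)))
    where
    open EquitableColouring n m binary f equitable
    open ≡-Reasoning

specialList : ∀ {k} → Fin k → Pair
specialList 0F = mkPair 2 3 (λ ())
specialList 1F = mkPair 0 2 (λ ())
specialList 2F = mkPair 0 2 (λ ())
specialList 3F = mkPair 0 3 (λ ())
specialList 4F = mkPair 0 3 (λ ())
specialList 5F = mkPair 1 2 (λ ())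
specialList 6F = mkPair 1 2 (λ ())
specialList 7F = mkPair 1 3 (λ ())
specialList 8F = mkPair 1 3 (λ ())
specialList _ = mkPair 0 2 (λ ())

pushed-leaf : ∀ {k} (s : Fin (suc k) → ℕ) (lists : Fin (suc k) → Pair) →
  (∀ p → s p ≡ fst (lists p) ⊎ s p ≡ snd (lists p)) → (∀ p → s 0F ≢ s (suc p)) →
  ∀ i → s 0F ≡ snd (lists (suc i)) → s (suc i) ≡ fst (lists (suc i))
pushed-leaf s lists in-list proper i centre≡snd with in-list (suc i)
... | inj₁ is-fst = is-fst
... | inj₂ is-snd = ⊥-elim (proper i (trans centre≡snd (sym is-snd)))

used-twice : ∀ {k} (s : Fin k → ℕ) {i j c} → i ≢ j → s i ≡ c → s j ≡ c → 2 ≤ occurrences s c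
used-twice s {i} {j} {c} i≢j si≡c sj≡c =
  subst (_≤ occurrences s c) (cong₂ _+_ (δ-≡ si≡c) (δ-≡ sj≡c)) (two-terms≤sum (λ p → δ (s p) c) i≢j)

special-star : ∀ {e} (s : Fin (suc (8 + e)) → ℕ) → (∀ p → s p ≡ fst (specialList p) ⊎ s p ≡ snd (specialList p)) →
  (∀ p → s 0F ≢ s (suc p)) → 2 ≤ occurrences s 0 × 2 ≤ occurrences s 1
special-star s in-list proper = by-centre (in-list 0F)
  where
  pushed : ∀ i → s 0F ≡ snd (specialList (suc i)) → s (suc i) ≡ fst (specialList (suc i))
  pushed = pushed-leaf s specialList in-list proper
  by-centre : s 0F ≡ 2 ⊎ s 0F ≡ 3 → 2 ≤ occurrences s 0 × 2 ≤ occurrences s 1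
  by-centre (inj₁ centre≡2) =
    used-twice s {1F} {2F} (λ ()) (pushed 0F centre≡2) (pushed 1F centre≡2) ,
    used-twice s {5F} {6F} (λ ()) (pushed 4F centre≡2) (pushed 5F centre≡2)
  by-centre (inj₂ centre≡3) =
    used-twice s {3F} {4F} (λ ()) (pushed 2F centre≡3) (pushed 3F centre≡3) ,
    used-twice s {7F} {8F} (λ ()) (pushed 6F centre≡3) (pushed 7F centre≡3)

even-counterexample : ∀ n m → 2 ≤ n → n % 2 ≡ 0 → 8 ≤ m → ¬ EquitablyChoosable (starForest n m) 2
even-counterexample n@(suc n-1@(suc _)) m _ even 8≤m with m≤n⇒∃[o]m+o≡n 8≤m
... | e , refl = λ choosable → no-equitable (choosable (pairAssignment n (8 + e) lists))
  where
  lists : Fin n → Fin (suc (8 + e)) → Pair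
  lists 0F = specialList
  lists (suc _) _ = P01
  no-equitable : ∃ (IsEquitableLColoring (pairAssignment n (8 + e) lists)) → ⊥
  no-equitable (f , equitable) =
    let (zeros₀ , ones₀) = special-star (colourAt 0F) (colour-in-list 0F) (centre≢leaf 0F)
        (p , q , p+q≡n-1 , zeros , ones) = binary-stars {n-1} suc (λ _ _ → refl)
        p≢q : p ≢ q
        p≢q = λ p≡q → 0≢1+n (begin
          0                 ≡⟨ even ⟨
          n % 2             ≡⟨ cong (λ t → suc t % 2) p+q≡n-1 ⟨
          suc (p + q) % 2   ≡⟨ cong (λ t → suc (p + t) % 2) p≡q ⟨
          suc (p + p) % 2   ≡⟨ double-odd p ⟩
          1                 ∎)
    in majority p≢q
         (λ p<q → not-overloaded 0 1F 0F (here refl) (≤-trans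
            (subst (λ k → suc (suc (suc k * suc (8 + e))) ≤ (2 + (p + (8 + e) * q)) * 2) p+q≡n-1 (even-excess p<q (s≤s z≤n)))
            (*-monoˡ-≤ 2 (+-mono-≤ zeros₀ (≤-reflexive (sym zeros))))))
         (λ q<p → not-overloaded 1 1F 0F (there (here refl)) (≤-trans
            (subst (λ k → suc (suc (suc k * suc (8 + e))) ≤ (2 + (q + (8 + e) * p)) * 2) (trans (+-comm q p) p+q≡n-1) (even-excess q<p (s≤s z≤n)))
            (*-monoˡ-≤ 2 (+-mono-≤ ones₀ (≤-reflexive (sym ones))))))
    where
    open EquitableColouring n (8 + e) lists f equitable
    open ≡-Reasoning

odd-form : ∀ n → n % 2 ≡ 1 → n ≡ suc (n / 2 * 2)
odd-form n odd = trans (m≡m%n+[m/n]*n n 2) (cong (_+ n / 2 * 2) odd)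

even-form : ∀ n → n % 2 ≡ 0 → n ≡ n / 2 * 2
even-form n even = trans (m≡m%n+[m/n]*n n 2) (cong (_+ n / 2 * 2) even)

theorem1p5 : (n m : ℕ) → 2 ≤ n → 1 ≤ m →
    ((n % 2 ≡ 1 → (EquitablyChoosable (starForest n m) 2 ⇔ m ≤ 2)) ×
     (n % 2 ≡ 0 → (EquitablyChoosable (starForest n m) 2 ⇔ m ≤ 7)))
theorem1p5 n m 2≤n 1≤m =
  (λ odd → mk⇔ (λ choosable → decidable-stable (m ≤? 2) (λ m≰2 → odd-counterexample n m odd (≰⇒> m≰2) choosable))
               (λ m≤2 → via (odd-form n odd) (odd-centres (n / 2) 1≤m m≤2))) ,
  (λ even → mk⇔ (λ choosable → decidable-stable (m ≤? 7) (λ m≰7 → even-counterexample n m 2≤n even (≰⇒> m≰7) choosable))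
                (λ m≤7 → via (even-form n even) (even-centres (n / 2) 1≤m m≤7)))
  where
  via : ∀ {k} → n ≡ k → CentresChoosable k m → EquitablyChoosable (starForest n m) 2
  via refl centres = sufficiency n m centres
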